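{- Let $m \ge 2$ and $i$ be integers with $2 \le i \le m$, and let $n \ge 1$. There is a bijection between (i) the set of $n$-color compositions of $n$ in which every color is congruent to $i$ modulo $m$, and (ii) the set of binary strings of length $n-1$ that begin with $1$ and in which every maximal run of consecutive $1$'s has length congruent to $i-1$ modulo $m$.
   Context: An $n$-color composition of a positive integer $n$ is a finite sequence of parts $(\kappa^{(1)}_{c_1}, \ldots, \kappa^{(r)}_{c_r})$, where $\kappa^{(1)}, \ldots, \kappa^{(r)}$ are positive integers with sum $n$ and each part $\kappa^{(j)}$ carries a color $c_j \in \{1, \ldots, \kappa^{(j)}\}$; two are the same iff they have the same sequence of (part, color) pairs. -}

module Defs where

open import Data.Nat using (ℕ; zero; suc; _+_; _∸_; _≤_; ∣_-_∣)
open import Data.Nat.Divisibility using (_∣_)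
open import Data.Bool using (Bool; true; false)
open import Data.List using (List; []; _∷_; map; length)
open import Data.Nat.ListAction using (sum)
open import Data.Empty using (⊥)
open import Data.List.Relation.Unary.All using (All)
open import Data.Product using (Σ; _×_; _,_; proj₁; proj₂)
open import Relation.Binary.PropositionalEquality using (_≡_)

_≡_[mod_] : ℕ → ℕ → ℕ → Set
a ≡ b [mod m ] = m ∣ ∣ a - b ∣

ColoredPart : Set
ColoredPart = ℕ × ℕ

part : ColoredPart → ℕ
part = proj₁

color : ColoredPart → ℕ
color = proj₂

ValidPart : ColoredPart → Set
ValidPart (k , c) = (1 ≤ c) × (c ≤ k)

IsNColorComposition : ℕ → List ColoredPart → Set
IsNColorComposition n ps = All ValidPart ps × (sum (map part ps) ≡ n)

CompColorsMod : ℕ → ℕ → ℕ → Set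
CompColorsMod m i n =
  Σ (List ColoredPart) λ ps →
    IsNColorComposition n ps × All (λ p → color p ≡ i [mod m ]) ps

-- Lengths of the maximal runs of consecutive 1's (true) in a binary string,
-- scanning left to right; acc is the length of the current run.
runsFrom : ℕ → List Bool → List ℕ
runsFrom zero [] = []
runsFrom (suc a) [] = suc a ∷ []
runsFrom acc (true ∷ bs) = runsFrom (suc acc) bs
runsFrom zero (false ∷ bs) = runsFrom zero bs
runsFrom (suc a) (false ∷ bs) = suc a ∷ runsFrom zero bs

onesRuns : List Bool → List ℕ
onesRuns = runsFrom zero

BeginsWith1 : List Bool → Set
BeginsWith1 [] = ⊥
BeginsWith1 (b ∷ _) = b ≡ true

StringsRunsMod : ℕ → ℕ → ℕ → Set
StringsRunsMod m i n =
  Σ (List Bool) λ bs →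
    (length bs ≡ n ∸ 1) × BeginsWith1 bs × All (λ r → r ≡ i ∸ 1 [mod m ]) (onesRuns bs)

-- A part κ_c with 2 ≤ c is sent to the block 0 1^(c-1) 0^(κ-c) of length κ; concatenating
-- the blocks of a composition of n gives a string of length n beginning with 01, and dropping
-- the leading 0 gives a string of length n-1 beginning with 1. The blocks are recovered from
-- the string by cutting before every 0 that is followed by a 1, so this is a bijection, and the
-- runs of 1's are exactly the colours minus one. Finally, when 2 ≤ i ≤ m a colour congruent to
-- i modulo m is never 1, so the colour condition forces every colour to be at least 2.
module Submission where

open import Defs
open import Axiom.UniquenessOfIdentityProofs using (module Decidable⇒UIP)
open import Data.Bool using (Bool; true; false)
import Data.Bool.Properties as Bool
open import Data.List using (List; []; _∷_; _++_; map; length; replicate; drop)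
open import Data.List.Properties using (length-++; length-replicate; length-drop; ∷-injectiveʳ)
open import Data.List.Relation.Unary.All as All using (All; []; _∷_)
open import Data.Nat using (ℕ; zero; suc; pred; _+_; _∸_; _≤_; s≤s; z≤n; NonZero)
open import Data.Nat.Divisibility using (_∣_; divides; ∣⇒≤)
open import Data.Nat.ListAction using (sum)
open import Data.Nat.Properties
open import Data.Product using (Σ; _×_; _,_; proj₁)
open import Data.Product.Properties using (Σ-≡,≡→≡)
open import Function using (_∘_)
open import Function.Bundles using (_⤖_; _↔_; _⇔_; mk↔ₛ′; mk⇔; module Equivalence)
open import Function.Properties.Inverse using (↔⇒⤖)
open import Relation.Nullary using (¬_; Irrelevant; contradiction)
open import Relation.Binary.PropositionalEquality
open ≡-Reasoning

replicate-suc-++ : ∀ {A : Set} n (x : A) xs → replicate (suc n) x ++ xs ≡ replicate n x ++ x ∷ xs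
replicate-suc-++ zero    x xs = refl
replicate-suc-++ (suc n) x xs = cong (x ∷_) (replicate-suc-++ n x xs)

length-replicate-++ : ∀ {A : Set} n (x : A) xs → length (replicate n x ++ xs) ≡ n + length xs
length-replicate-++ n x xs = trans (length-++ (replicate n x)) (cong (_+ length xs) (length-replicate n))

×-irrelevant : ∀ {A B : Set} → Irrelevant A → Irrelevant B → Irrelevant (A × B)
×-irrelevant A-irr B-irr (a , b) (a′ , b′) = cong₂ _,_ (A-irr a a′) (B-irr b b′)

subtype-↔ : ∀ {A B : Set} {P : A → Set} {Q : B → Set} →
  (∀ {a} → Irrelevant (P a)) → (∀ {b} → Irrelevant (Q b)) →
  (f : A → B) (g : B → A) → (∀ {a} → P a → Q (f a)) → (∀ {b} → Q b → P (g b)) →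
  (∀ {a} → P a → g (f a) ≡ a) → (∀ {b} → Q b → f (g b) ≡ b) →
  Σ A P ↔ Σ B Q
subtype-↔ P-irr Q-irr f g f-resp g-resp gf≗id fg≗id = mk↔ₛ′
  (λ (a , p) → f a , f-resp p)
  (λ (b , q) → g b , g-resp q)
  (λ (b , q) → Σ-≡,≡→≡ (fg≗id q , Q-irr _ q))
  (λ (a , p) → Σ-≡,≡→≡ (gf≗id p , P-irr _ p))

∣-irrelevant : ∀ {m n} .{{_ : NonZero m}} → Irrelevant (m ∣ n)
∣-irrelevant {m} (divides q₁ e₁) (divides q₂ e₂) with *-cancelʳ-≡ q₁ q₂ m (trans (sym e₁) e₂)
... | refl = cong (divides q₁) (≡-irrelevant e₁ e₂)

ValidPart≥2 : ColoredPart → Set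
ValidPart≥2 (k , c) = (2 ≤ c) × (c ≤ k)

ValidPart≥2⇒ValidPart : ∀ {p} → ValidPart≥2 p → ValidPart p
ValidPart≥2⇒ValidPart (s≤s _ , c≤k) = s≤s z≤n , c≤k

blocks : List ColoredPart → List Bool
blocks []             = []
blocks ((k , c) ∷ ps) = false ∷ replicate (pred c) true ++ replicate (k ∸ c) false ++ blocks ps

encode : List ColoredPart → List Bool
encode = drop 1 ∘ blocks

length-blocks : ∀ {ps} → All ValidPart ps → length (blocks ps) ≡ sum (map part ps)
length-blocks [] = refl
length-blocks {(k , suc c) ∷ ps} ((_ , c≤k) ∷ vs) = begin
  suc (length (replicate c true ++ replicate (k ∸ suc c) false ++ blocks ps))
    ≡⟨ cong suc (length-replicate-++ c true _) ⟩
  suc (c + length (replicate (k ∸ suc c) false ++ blocks ps))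
    ≡⟨ cong (λ l → suc (c + l)) (length-replicate-++ (k ∸ suc c) false _) ⟩
  suc c + ((k ∸ suc c) + length (blocks ps))
    ≡⟨ sym (+-assoc (suc c) (k ∸ suc c) _) ⟩
  (suc c + (k ∸ suc c)) + length (blocks ps)
    ≡⟨ cong₂ _+_ (m+[n∸m]≡n c≤k) (length-blocks vs) ⟩
  k + sum (map part ps) ∎

runsFrom-ones : ∀ a k r → runsFrom a (replicate k true ++ r) ≡ runsFrom (a + k) r
runsFrom-ones a zero    r = cong (λ x → runsFrom x r) (sym (+-identityʳ a))
runsFrom-ones zero    (suc k) r = runsFrom-ones 1 k r
runsFrom-ones (suc a) (suc k) r =
  trans (runsFrom-ones (2 + a) k r) (cong (λ x → runsFrom (suc x) r) (sym (+-suc a k)))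

runsFrom-zeros : ∀ k r → runsFrom 0 (replicate k false ++ r) ≡ runsFrom 0 r
runsFrom-zeros zero    r = refl
runsFrom-zeros (suc k) r = runsFrom-zeros k r

runsFrom-zeros-blocks : ∀ a k ps → runsFrom (suc a) (replicate k false ++ blocks ps) ≡ suc a ∷ runsFrom 0 (blocks ps)
runsFrom-zeros-blocks a (suc k) ps      = cong (suc a ∷_) (runsFrom-zeros k (blocks ps))
runsFrom-zeros-blocks a zero    []      = refl
runsFrom-zeros-blocks a zero    (_ ∷ _) = refl

runsFrom-blocks : ∀ {ps} → All ValidPart≥2 ps → runsFrom 0 (blocks ps) ≡ map (pred ∘ color) ps
runsFrom-blocks [] = refl
runsFrom-blocks {(k , suc (suc c)) ∷ ps} ((s≤s (s≤s _) , _) ∷ vs) = begin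
  runsFrom 1 (replicate c true ++ replicate (k ∸ suc (suc c)) false ++ blocks ps)
    ≡⟨ runsFrom-ones 1 c _ ⟩
  runsFrom (suc c) (replicate (k ∸ suc (suc c)) false ++ blocks ps)
    ≡⟨ runsFrom-zeros-blocks c (k ∸ suc (suc c)) ps ⟩
  suc c ∷ runsFrom 0 (blocks ps)
    ≡⟨ cong (suc c ∷_) (runsFrom-blocks vs) ⟩
  suc c ∷ map (pred ∘ color) ps ∎

onesRuns-encode : ∀ {ps} → All ValidPart≥2 ps → onesRuns (encode ps) ≡ map (pred ∘ color) ps
onesRuns-encode []         = refl
onesRuns-encode vs@(_ ∷ _) = runsFrom-blocks vs

-- decodeFrom a b t lists the parts of the string 0 1^(1+a) 0^b t.
decodeFrom : ℕ → ℕ → List Bool → List ColoredPart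
decodeFrom a b       []          = (2 + a + b , 2 + a) ∷ []
decodeFrom a b       (false ∷ t) = decodeFrom a (suc b) t
decodeFrom a zero    (true ∷ t)  = decodeFrom (suc a) zero t
decodeFrom a (suc b) (true ∷ t)  = (2 + a + b , 2 + a) ∷ decodeFrom 0 0 t

decode : List Bool → List ColoredPart
decode []          = []
decode (false ∷ _) = []
decode (true ∷ t)  = decodeFrom 0 0 t

decodeFrom-ones : ∀ a k r → decodeFrom a 0 (replicate k true ++ r) ≡ decodeFrom (a + k) 0 r
decodeFrom-ones a zero    r = cong (λ x → decodeFrom x 0 r) (sym (+-identityʳ a))
decodeFrom-ones a (suc k) r = trans (decodeFrom-ones (suc a) k r) (cong (λ x → decodeFrom x 0 r) (sym (+-suc a k)))

decodeFrom-zeros : ∀ a b k r → decodeFrom a b (replicate k false ++ r) ≡ decodeFrom a (b + k) r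
decodeFrom-zeros a b zero    r = cong (λ x → decodeFrom a x r) (sym (+-identityʳ b))
decodeFrom-zeros a b (suc k) r = trans (decodeFrom-zeros a (suc b) k r) (cong (λ x → decodeFrom a x r) (sym (+-suc b k)))

decodeFrom-blocks : ∀ a b {ps} → All ValidPart≥2 ps → decodeFrom a b (blocks ps) ≡ (2 + a + b , 2 + a) ∷ ps
decodeFrom-blocks a b [] = refl
decodeFrom-blocks a b {(k , suc (suc c)) ∷ ps} ((s≤s (s≤s _) , c≤k) ∷ vs) = cong (_ ∷_) (begin
  decodeFrom 0 0 (replicate c true ++ replicate (k ∸ suc (suc c)) false ++ blocks ps)
    ≡⟨ decodeFrom-ones 0 c _ ⟩
  decodeFrom c 0 (replicate (k ∸ suc (suc c)) false ++ blocks ps)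
    ≡⟨ decodeFrom-zeros c 0 _ (blocks ps) ⟩
  decodeFrom c (k ∸ suc (suc c)) (blocks ps)
    ≡⟨ decodeFrom-blocks c _ vs ⟩
  (suc (suc c) + (k ∸ suc (suc c)) , suc (suc c)) ∷ ps
    ≡⟨ cong (λ l → (l , suc (suc c)) ∷ ps) (m+[n∸m]≡n c≤k) ⟩
  (k , suc (suc c)) ∷ ps ∎)

-- decodeFrom 0 0 reads the leading 01 of the blocks as a part 2₂ and then continues as decode.
decode-encode : ∀ {ps} → All ValidPart≥2 ps → decode (encode ps) ≡ ps
decode-encode [] = refl
decode-encode vs@((s≤s (s≤s _) , _) ∷ _) = ∷-injectiveʳ (decodeFrom-blocks 0 0 vs)

blocks-decodeFrom : ∀ a b t → blocks (decodeFrom a b t) ≡ false ∷ replicate (suc a) true ++ replicate b false ++ t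
blocks-decodeFrom a b [] =
  cong (λ l → false ∷ replicate (suc a) true ++ replicate l false ++ []) (m+n∸m≡n a b)
blocks-decodeFrom a b (false ∷ t) =
  trans (blocks-decodeFrom a (suc b) t)
        (cong (λ r → false ∷ replicate (suc a) true ++ r) (replicate-suc-++ b false t))
blocks-decodeFrom a zero (true ∷ t) =
  trans (blocks-decodeFrom (suc a) 0 t) (cong (false ∷_) (replicate-suc-++ (suc a) true t))
blocks-decodeFrom a (suc b) (true ∷ t) =
  trans (cong₂ (λ l r → false ∷ replicate (suc a) true ++ replicate l false ++ r)
               (m+n∸m≡n a b) (blocks-decodeFrom 0 0 t))
        (cong (λ r → false ∷ replicate (suc a) true ++ r) (sym (replicate-suc-++ b false (true ∷ t))))

blocks-decode : ∀ s → BeginsWith1 s → blocks (decode s) ≡ false ∷ s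
blocks-decode (true ∷ t) refl = blocks-decodeFrom 0 0 t

encode-decode : ∀ s → BeginsWith1 s → encode (decode s) ≡ s
encode-decode s b = cong (drop 1) (blocks-decode s b)

decodeFrom-valid : ∀ a b t → All ValidPart≥2 (decodeFrom a b t)
decodeFrom-valid a b       []          = (s≤s (s≤s z≤n) , s≤s (s≤s (m≤m+n a b))) ∷ []
decodeFrom-valid a b       (false ∷ t) = decodeFrom-valid a (suc b) t
decodeFrom-valid a zero    (true ∷ t)  = decodeFrom-valid (suc a) zero t
decodeFrom-valid a (suc b) (true ∷ t)  = (s≤s (s≤s z≤n) , s≤s (s≤s (m≤m+n a b))) ∷ decodeFrom-valid 0 0 t

decode-valid : ∀ s → All ValidPart≥2 (decode s)
decode-valid []          = []
decode-valid (false ∷ _) = []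
decode-valid (true ∷ t)  = decodeFrom-valid 0 0 t

encode-length : ∀ {n ps} → IsNColorComposition n ps → length (encode ps) ≡ n ∸ 1
encode-length {n} {ps} (vs , Σ≡n) = begin
  length (drop 1 (blocks ps)) ≡⟨ length-drop 1 (blocks ps) ⟩
  length (blocks ps) ∸ 1      ≡⟨ cong (_∸ 1) (trans (length-blocks vs) Σ≡n) ⟩
  n ∸ 1                       ∎

encode-beginsWith1 : ∀ {p ps} → ValidPart≥2 p → BeginsWith1 (encode (p ∷ ps))
encode-beginsWith1 (s≤s (s≤s _) , _) = refl

decode-composition : ∀ {n s} → 1 ≤ n → length s ≡ n ∸ 1 → BeginsWith1 s →
  IsNColorComposition n (decode s)
decode-composition {n} {s} 1≤n len b = valid , (begin
  sum (map part (decode s)) ≡⟨ sym (length-blocks valid) ⟩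
  length (blocks (decode s)) ≡⟨ cong length (blocks-decode s b) ⟩
  suc (length s)             ≡⟨ cong suc len ⟩
  suc (n ∸ 1)                ≡⟨ m+[n∸m]≡n 1≤n ⟩
  n                          ∎)
  where valid = All.map ValidPart≥2⇒ValidPart (decode-valid s)

onesRuns-decode : ∀ s → BeginsWith1 s → onesRuns s ≡ map (pred ∘ color) (decode s)
onesRuns-decode s b = trans (cong onesRuns (sym (encode-decode s b))) (onesRuns-encode (decode-valid s))

1≢i-mod : ∀ {m i} → 2 ≤ i → i ≤ m → ¬ 1 ≡ i [mod m ]
1≢i-mod (s≤s (s≤s _)) i≤m m∣i-1 = <-irrefl refl (≤-trans i≤m (∣⇒≤ m∣i-1))

ValidPart⇒ValidPart≥2 : ∀ {m i p} → 2 ≤ i → i ≤ m → ValidPart p → color p ≡ i [mod m ] → ValidPart≥2 p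
ValidPart⇒ValidPart≥2 {p = k , suc zero}    2≤i i≤m _ c≡i = contradiction c≡i (1≢i-mod 2≤i i≤m)
ValidPart⇒ValidPart≥2 {p = k , suc (suc c)} _   _   (_ , c≤k) _ = s≤s (s≤s z≤n) , c≤k

-- Both sides agree entrywise by definition, since ∣ suc a - suc b ∣ = ∣ a - b ∣.
colours⇔runs-mod : ∀ {m j ps} → All ValidPart ps →
  All (λ p → color p ≡ suc j [mod m ]) ps ⇔ All (λ r → r ≡ j [mod m ]) (map (pred ∘ color) ps)
colours⇔runs-mod [] = mk⇔ (λ _ → []) (λ _ → [])
colours⇔runs-mod {ps = (k , suc c) ∷ _} ((s≤s z≤n , _) ∷ vs) =
  mk⇔ (λ { (e ∷ es) → e ∷ to es }) (λ { (e ∷ es) → e ∷ from es })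
  where open Equivalence (colours⇔runs-mod vs)

BeginsWith1-irrelevant : ∀ s → Irrelevant (BeginsWith1 s)
BeginsWith1-irrelevant (_ ∷ _) = Decidable⇒UIP.≡-irrelevant Bool._≟_

CompositionMod : ℕ → ℕ → ℕ → List ColoredPart → Set
CompositionMod m i n ps = IsNColorComposition n ps × All (λ p → color p ≡ i [mod m ]) ps

StringMod : ℕ → ℕ → ℕ → List Bool → Set
StringMod m i n s =
  (length s ≡ n ∸ 1) × BeginsWith1 s × All (λ r → r ≡ i ∸ 1 [mod m ]) (onesRuns s)

CompositionMod-irrelevant : ∀ {m i n ps} .{{_ : NonZero m}} → Irrelevant (CompositionMod m i n ps)
CompositionMod-irrelevant = ×-irrelevant
  (×-irrelevant (All.irrelevant (×-irrelevant ≤-irrelevant ≤-irrelevant)) ≡-irrelevant)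
  (All.irrelevant ∣-irrelevant)

StringMod-irrelevant : ∀ {m i n s} .{{_ : NonZero m}} → Irrelevant (StringMod m i n s)
StringMod-irrelevant {s = s} =
  ×-irrelevant ≡-irrelevant (×-irrelevant (BeginsWith1-irrelevant s) (All.irrelevant ∣-irrelevant))

CompositionMod⇒ValidPart≥2 : ∀ {m i n ps} → 2 ≤ i → i ≤ m → CompositionMod m i n ps → All ValidPart≥2 ps
CompositionMod⇒ValidPart≥2 2≤i i≤m ((vs , _) , cs) =
  All.zipWith (λ (v , c) → ValidPart⇒ValidPart≥2 2≤i i≤m v c) (vs , cs)

encode-StringMod : ∀ {m j n ps} → 2 ≤ suc j → suc j ≤ m → 1 ≤ n →
  CompositionMod m (suc j) n ps → StringMod m (suc j) n (encode ps)
encode-StringMod {ps = []} _ _ 1≤n ((_ , refl) , _) = contradiction 1≤n λ ()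
encode-StringMod {ps = _ ∷ _} 2≤i i≤m _ c@((vs , _) , cs) =
  encode-length (proj₁ c) , encode-beginsWith1 (All.head valid≥2) ,
  subst (All _) (sym (onesRuns-encode valid≥2)) (Equivalence.to (colours⇔runs-mod vs) cs)
  where valid≥2 = CompositionMod⇒ValidPart≥2 2≤i i≤m c

decode-CompositionMod : ∀ {m j n s} → 1 ≤ n → StringMod m (suc j) n s → CompositionMod m (suc j) n (decode s)
decode-CompositionMod {s = s} 1≤n (len , b , rs) =
  comp , Equivalence.from (colours⇔runs-mod (proj₁ comp)) (subst (All _) (onesRuns-decode s b) rs)
  where comp = decode-composition 1≤n len b

proposition14 : (m i n : ℕ) → 2 ≤ m → 2 ≤ i → i ≤ m → 1 ≤ n →
    CompColorsMod m i n ⤖ StringsRunsMod m i n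
-- The two matches expose m = suc _ (for the NonZero m instance) and i = suc _.
proposition14 m i n (s≤s _) 2≤i@(s≤s _) i≤m 1≤n = ↔⇒⤖ (subtype-↔
  (CompositionMod-irrelevant {m} {i} {n}) (StringMod-irrelevant {m} {i} {n})
  encode decode
  (encode-StringMod 2≤i i≤m 1≤n) (decode-CompositionMod 1≤n)
  (decode-encode ∘ CompositionMod⇒ValidPart≥2 2≤i i≤m)
  (λ (_ , b , _) → encode-decode _ b))
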